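{- Let $p_k\ge 3$ be a prime, $p_{k+1}$ the next prime, $N=p_k\#$, $N'=p_{k+1}\#$. Let $s=(s_1,\dots,s_j)$ be a constellation of length $j$ and sum $g=s_1+\dots+s_j<2p_{k+1}$. Consider an occurrence of $s$ in $\mathcal{G}(N)$, i.e. integers $x_0<x_1<\dots<x_j$ that are consecutive among the integers coprime to $N$, with $x_i-x_{i-1}=s_i$. For $t=0,\dots,p_{k+1}-1$ consider the copy $x_0+tN<\dots<x_j+tN$. Then: (i) for each $i\in\{0,\dots,j\}$ there is exactly one $t_i\in\{0,\dots,p_{k+1}-1\}$ with $p_{k+1}\mid x_i+t_iN$, and $t_0,\dots,t_j$ are pairwise distinct (the $j+1$ closures occur in distinct copies); (ii) for each of the $p_{k+1}-j-1$ values $t\notin\{t_0,\dots,t_j\}$, the integers $x_0+tN,\dots,x_j+tN$ are consecutive among the integers coprime to $N'$, so they give an occurrence of $s$ in $\mathcal{G}(N')$; (iii) for $t=t_i$ with $0<i<j$, the integers $x_0+tN,\dots,x_j+tN$ with $x_i+tN$ removed are consecutive among the integers coprime to $N'$, giving an occurrence in $\mathcal{G}(N')$ of a constellation of length $j-1$ and sum $g$ (namely $s$ with $s_i,s_{i+1}$ replaced by $s_i+s_{i+1}$); (iv) for $t=t_0$ and $t=t_j$ (two distinct copies) an endpoint $x_0+tN$, respectively $x_j+tN$, is divisible by $p_{k+1}$, so the gap sequence from that copy is extended beyond sum $g$ and is no longer a driving term of sum $g$ with those endpoints.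
   Context: For a prime $p$, $p\#$ denotes the product of all primes $\le p$. For a positive integer $N$, $\mathcal{G}(N)$ (the cycle of gaps) is the sequence of differences between consecutive integers coprime to $N$ in $[1,N+1]$, read cyclically; it is the period of the sequence of differences between consecutive positive integers coprime to $N$. A constellation is a finite sequence of positive integers; an occurrence of it in $\mathcal{G}(N)$ is a run of consecutive gaps equal to it. -}

module Defs where

open import Data.Nat using (ℕ; zero; suc; _+_; _*_; _∸_; _≤_; _<_)
open import Data.Nat.Primality using (Prime; prime?)
open import Data.Nat.Coprimality using (Coprime)
open import Data.Bool using (if_then_else_)
open import Data.List using (List; []; _∷_; map)
open import Data.List.Membership.Propositional using (_∈_)
open import Data.List.Relation.Unary.All using (All)
open import Data.List.Relation.Unary.Linked using (Linked)
open import Data.Product using (∃; _×_)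
open import Relation.Nullary using (¬_; does)
open import Relation.Binary.PropositionalEquality using (_≡_)

primorial : ℕ → ℕ
primorial zero = 1
primorial (suc n) = if does (prime? (suc n)) then suc n * primorial n else primorial n

NextPrime : ℕ → ℕ → Set
NextPrime p q = Prime q × p < q × (∀ r → p < r → r < q → ¬ Prime r)

gaps : List ℕ → List ℕ
gaps (a ∷ b ∷ r) = (b ∸ a) ∷ gaps (b ∷ r)
gaps _ = []

ConsecCoprime : ℕ → List ℕ → Set
ConsecCoprime M xs =
  Linked _<_ xs ×
  All (λ x → Coprime x M) xs ×
  (∀ z → (∃ λ a → a ∈ xs × a ≤ z) → (∃ λ b → b ∈ xs × z ≤ b) → Coprime z M → z ∈ xs)

OccursAt : ℕ → List ℕ → List ℕ → Set
OccursAt M s xs = ConsecCoprime M xs × gaps xs ≡ s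

shift : ℕ → ℕ → List ℕ → List ℕ
shift N t = map (λ x → x + t * N)

-- remove the entry at (0-based) position i
dropAt : ℕ → List ℕ → List ℕ
dropAt _ [] = []
dropAt zero (x ∷ xs) = xs
dropAt (suc i) (x ∷ xs) = x ∷ dropAt i xs

-- replace the entries at 0-based positions k, k+1 by their sum
mergeAt : ℕ → List ℕ → List ℕ
mergeAt zero (a ∷ b ∷ r) = (a + b) ∷ r
mergeAt (suc k) (a ∷ r) = a ∷ mergeAt k r
mergeAt _ r = r

-- Since q = p_{k+1} does not divide N = p_k#, for every x exactly one t < q makes
-- q ∣ x + t N; these are the copies t_i in which the entries get closed.  Two entries
-- of one copy cannot both be multiples of q: they differ by less than 2q, hence by
-- exactly q, which would make one of them even although all are coprime to the even N.
-- So the t_i are distinct.  As N' = q N, an integer is coprime to N' iff it is coprime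
-- to N and not divisible by q; a copy is again a run of consecutive integers coprime
-- to N, and deleting its multiples of q (none, or the single entry x_i + t_i N) leaves
-- a run of consecutive integers coprime to N'.
module Submission where

open import Defs
open import Data.Fin using (Fin; toℕ; fromℕ) renaming (zero to fzero; suc to fsuc)
open import Data.Fin.Properties using (toℕ-fromℕ)
open import Data.List using (List; []; _∷_; length; lookup; map)
open import Data.List.Membership.Propositional using (_∈_; _∉_)
open import Data.List.Membership.Propositional.Properties using (∈-lookup; ∈-map⁺; ∈-map⁻)
open import Data.List.Relation.Binary.Subset.Propositional using (_⊆_)
import Data.List.Relation.Binary.Subset.Propositional.Properties as Subset
open import Data.List.Relation.Unary.All as All using (All)
import Data.List.Relation.Unary.All.Properties as All
open import Data.List.Relation.Unary.Any using (here; there; index)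
open import Data.List.Relation.Unary.Any.Properties using (lookup-index)
open import Data.List.Relation.Unary.Linked as Linked using (Linked; []; [-]; _∷_)
import Data.List.Relation.Unary.Linked.Properties as Linked
open import Data.Nat using (ℕ; zero; suc; _+_; _*_; _∸_; _≤_; _<_; z≤n; s≤s; _%_; _/_; nonTrivial⇒n>1)
open import Data.Nat.Coprimality using (Coprime; coprime-Bézout; coprime-divisor)
open import Data.Nat.DivMod using (m≡m%n+[m/n]*n; m%n<n; %-distribˡ-+)
open import Data.Nat.Divisibility
open import Data.Nat.GCD using (module Bézout)
open import Data.Nat.ListAction using (sum)
open import Data.Nat.Primality
open import Data.Nat.Properties
open import Data.Nat.Tactic.RingSolver using (solve-∀)
open import Data.Product using (Σ; ∃; _×_; _,_; proj₁; proj₂)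
open import Data.Sum using (inj₁; inj₂)
open import Function using (_∘′_)
open import Function.Definitions using (Injective)
open import Relation.Binary.Definitions using (tri<; tri≈; tri>)
open import Relation.Binary.PropositionalEquality
open import Relation.Nullary using (¬_; yes; no; contradiction)

prime⇒1< : ∀ {q} → Prime q → 1 < q
prime⇒1< {q} pq = nonTrivial⇒n>1 q {{prime⇒nonTrivial pq}}

primorial-prime : ∀ {n} → Prime (suc n) → primorial (suc n) ≡ suc n * primorial n
primorial-prime {n} pr with prime? (suc n)
... | yes _ = refl
... | no ¬pr = contradiction pr ¬pr

primorial-¬prime : ∀ {n} → ¬ Prime (suc n) → primorial (suc n) ≡ primorial n
primorial-¬prime {n} ¬pr with prime? (suc n)
... | yes pr = contradiction pr ¬pr
... | no _ = refl

primorial∣primorial-suc : ∀ n → primorial n ∣ primorial (suc n)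
primorial∣primorial-suc n with prime? (suc n)
... | yes _ = n∣m*n (suc n)
... | no _ = ∣-refl

prime∣primorial : ∀ {r n} → Prime r → r ≤ n → r ∣ primorial n
prime∣primorial {n = zero} pr r≤0 = contradiction (<-≤-trans (prime⇒1< pr) r≤0) λ ()
prime∣primorial {n = suc n} pr r≤1+n with m≤n⇒m<n∨m≡n r≤1+n
... | inj₁ r<1+n = ∣-trans (prime∣primorial pr (≤-pred r<1+n)) (primorial∣primorial-suc n)
... | inj₂ refl = subst (suc n ∣_) (sym (primorial-prime pr)) (m∣m*n (primorial n))

prime∤primorial : ∀ {r n} → Prime r → n < r → ¬ r ∣ primorial n
prime∤primorial {n = zero} pr _ r∣1 = <⇒≢ (prime⇒1< pr) (sym (∣1⇒≡1 r∣1))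
prime∤primorial {n = suc n} pr n<r r∣ with prime? (suc n)
... | no _ = prime∤primorial pr (<-trans (n<1+n n) n<r) r∣
... | yes _ with euclidsLemma (suc n) (primorial n) pr r∣
...   | inj₁ r∣1+n = <⇒≱ n<r (∣⇒≤ r∣1+n)
...   | inj₂ r∣′ = prime∤primorial pr (<-trans (n<1+n n) n<r) r∣′

primorial-constant : ∀ m k → (∀ r → m < r → r ≤ m + k → ¬ Prime r) →
                     primorial (m + k) ≡ primorial m
primorial-constant m zero _ = cong primorial (+-identityʳ m)
primorial-constant m (suc k) noPrime = begin
  primorial (m + suc k)   ≡⟨ cong primorial (+-suc m k) ⟩
  primorial (suc (m + k)) ≡⟨ primorial-¬prime (noPrime (suc (m + k)) m<1+m+k 1+m+k≤m+1+k) ⟩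
  primorial (m + k)       ≡⟨ primorial-constant m k noPrime′ ⟩
  primorial m             ∎
  where
  open ≡-Reasoning
  m<1+m+k : m < suc (m + k)
  m<1+m+k = s≤s (m≤m+n m k)
  1+m+k≤m+1+k : suc (m + k) ≤ m + suc k
  1+m+k≤m+1+k = ≤-reflexive (sym (+-suc m k))
  noPrime′ : ∀ r → m < r → r ≤ m + k → ¬ Prime r
  noPrime′ r m<r r≤m+k = noPrime r m<r (≤-trans r≤m+k (+-monoʳ-≤ m (n≤1+n k)))

primorial-nextPrime : ∀ {p q} → NextPrime p q → primorial q ≡ q * primorial p
primorial-nextPrime {q = zero} (pq , _) = contradiction (prime⇒1< pq) λ ()
primorial-nextPrime {p} {suc m} (pq , p<q , gap) = begin
  primorial (suc m)               ≡⟨ primorial-prime pq ⟩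
  suc m * primorial m             ≡⟨ cong (λ n → suc m * primorial n) (sym p+[m∸p]≡m) ⟩
  suc m * primorial (p + (m ∸ p)) ≡⟨ cong (suc m *_) (primorial-constant p (m ∸ p) noPrime) ⟩
  suc m * primorial p             ∎
  where
  open ≡-Reasoning
  p+[m∸p]≡m : p + (m ∸ p) ≡ m
  p+[m∸p]≡m = m+[n∸m]≡n (≤-pred p<q)
  noPrime : ∀ r → p < r → r ≤ p + (m ∸ p) → ¬ Prime r
  noPrime r p<r r≤ = gap r p<r (s≤s (≤-trans r≤ (≤-reflexive p+[m∸p]≡m)))

coprime-+-* : ∀ {x M} t → Coprime x M → Coprime (x + t * M) M
coprime-+-* {x} {M} t c {d} (d∣x+tM , d∣M) =
  c (∣m+n∣m⇒∣n (subst (d ∣_) (+-comm x (t * M)) d∣x+tM) (∣n⇒∣m*n t d∣M) , d∣M)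

coprime-+-*⁻ : ∀ {x M} t → Coprime (x + t * M) M → Coprime x M
coprime-+-*⁻ t c (d∣x , d∣M) = c (∣m∣n⇒∣m+n d∣x (∣n⇒∣m*n t d∣M) , d∣M)

prime∤⇒coprime : ∀ {q x} → Prime q → ¬ q ∣ x → Coprime x q
prime∤⇒coprime pq q∤x (d∣x , d∣q) with prime⇒irreducible pq d∣q
... | inj₁ d≡1 = d≡1
... | inj₂ refl = contradiction d∣x q∤x

coprime-* : ∀ {x q M} → Coprime x q → Coprime x M → Coprime x (q * M)
coprime-* cq cM (d∣x , d∣qM) =
  cM (d∣x , coprime-divisor (λ (e∣d , e∣q) → cq (∣-trans e∣d d∣x , e∣q)) d∣qM)

coprime-*⁻ : ∀ {x q M} → Coprime x (q * M) → Coprime x M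
coprime-*⁻ {q = q} c (d∣x , d∣M) = c (d∣x , ∣n⇒∣m*n q d∣M)

∣∧∣⇒¬coprime : ∀ {d x M} → 1 < d → d ∣ x → d ∣ M → ¬ Coprime x M
∣∧∣⇒¬coprime 1<d d∣x d∣M c = <⇒≢ 1<d (sym (c (d∣x , d∣M)))

odd⇒%2≡1 : ∀ a → ¬ 2 ∣ a → a % 2 ≡ 1
odd⇒%2≡1 a 2∤a with a % 2 in eq | m%n<n a 2
... | 0 | _ = contradiction (m%n≡0⇒n∣m a 2 eq) 2∤a
... | 1 | _ = refl
... | suc (suc _) | s≤s (s≤s ())

odd+odd⇒even : ∀ a b → ¬ 2 ∣ a → ¬ 2 ∣ b → 2 ∣ a + b
odd+odd⇒even a b 2∤a 2∤b = m%n≡0⇒n∣m (a + b) 2 (begin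
  (a + b) % 2         ≡⟨ %-distribˡ-+ a b 2 ⟩
  (a % 2 + b % 2) % 2 ≡⟨ cong₂ (λ u v → (u + v) % 2) (odd⇒%2≡1 a 2∤a) (odd⇒%2≡1 b 2∤b) ⟩
  0                   ∎)
  where open ≡-Reasoning

0<m<2n∧n∣m⇒m≡n : ∀ {d q} → 0 < d → d < 2 * q → q ∣ d → d ≡ q
0<m<2n∧n∣m⇒m≡n 0<d _ (divides zero refl) = contradiction 0<d λ ()
0<m<2n∧n∣m⇒m≡n {q = q} _ _ (divides 1 refl) = +-identityʳ q
0<m<2n∧n∣m⇒m≡n {q = q} _ d<2q (divides (suc (suc c)) refl) =
  contradiction d<2q (≤⇒≯ (+-monoʳ-≤ q q+0≤q+cq))
  where
  q+0≤q+cq : q + 0 ≤ q + c * q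
  q+0≤q+cq = ≤-trans (≤-reflexive (+-identityʳ q)) (m≤m+n q (c * q))

∃-inverse : ∀ {q N} → Prime q → ¬ q ∣ N → ∃ λ u → q ∣ 1 + u * N
∃-inverse {q} {N} pq q∤N with coprime-Bézout (prime∤⇒coprime pq q∤N)
... | Bézout.-+ x y 1+xN≡yq = x , divides y 1+xN≡yq
∃-inverse {zero} pq q∤N | Bézout.+- x y 1+y0≡xN = contradiction (prime⇒1< pq) λ ()
∃-inverse {suc r} {N} pq q∤N | Bézout.+- x y 1+yq≡xN = r * x , divides (1 + r * y) (begin
    1 + r * x * N           ≡⟨ cong (1 +_) (*-assoc r x N) ⟩
    1 + r * (x * N)         ≡⟨ cong (λ m → 1 + r * m) (sym 1+yq≡xN) ⟩
    1 + r * (1 + y * suc r) ≡⟨ factor r y ⟩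
    (1 + r * y) * suc r     ∎)
  where
  open ≡-Reasoning
  factor : ∀ r y → 1 + r * (1 + y * suc r) ≡ (1 + r * y) * suc r
  factor = solve-∀

∃-solution : ∀ {q N} → Prime q → ¬ q ∣ N → ∀ a → ∃ λ t → t < q × q ∣ a + t * N
∃-solution {q} {N} pq q∤N a with ∃-inverse pq q∤N
... | u , q∣1+uN = (a * u) % q , m%n<n (a * u) q , ∣m+n∣m⇒∣n q∣sum (n∣m*n*o ((a * u) / q) N)
  where
  instance _ = prime⇒nonZero pq
  open ≡-Reasoning
  expand : ∀ a u N → a * (1 + u * N) ≡ a + a * u * N
  expand = solve-∀
  regroup : ∀ a r d q N → a + (r + d * q) * N ≡ d * q * N + (a + r * N)
  regroup = solve-∀
  q∣sum : q ∣ (a * u) / q * q * N + (a + (a * u) % q * N)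
  q∣sum = subst (q ∣_) (begin
    a * (1 + u * N)                          ≡⟨ expand a u N ⟩
    a + a * u * N                            ≡⟨ cong (λ m → a + m * N) (m≡m%n+[m/n]*n (a * u) q) ⟩
    a + ((a * u) % q + (a * u) / q * q) * N  ≡⟨ regroup a ((a * u) % q) ((a * u) / q) q N ⟩
    (a * u) / q * q * N + (a + (a * u) % q * N) ∎) (∣n⇒∣m*n a q∣1+uN)

solution-unique-≤ : ∀ {q N a t t′} → Prime q → ¬ q ∣ N → t ≤ t′ → t′ < q →
                    q ∣ a + t * N → q ∣ a + t′ * N → t ≡ t′
solution-unique-≤ {q} {N} {a} {t} {t′} pq q∤N t≤t′ t′<q q∣a+tN q∣a+t′N
  with euclidsLemma (t′ ∸ t) N pq (∣m+n∣m⇒∣n (subst (q ∣_) split q∣a+t′N) q∣a+tN)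
  where
  open ≡-Reasoning
  split : a + t′ * N ≡ (a + t * N) + (t′ ∸ t) * N
  split = begin
    a + t′ * N                 ≡⟨ cong (λ m → a + m * N) (sym (m+[n∸m]≡n t≤t′)) ⟩
    a + (t + (t′ ∸ t)) * N     ≡⟨ cong (a +_) (*-distribʳ-+ N t (t′ ∸ t)) ⟩
    a + (t * N + (t′ ∸ t) * N) ≡⟨ +-assoc a (t * N) _ ⟨
    (a + t * N) + (t′ ∸ t) * N ∎
... | inj₂ q∣N = contradiction q∣N q∤N
... | inj₁ q∣t′∸t with t′ ∸ t in eq
...   | zero = ≤-antisym t≤t′ (m∸n≡0⇒m≤n eq)
...   | suc k = contradiction q∣t′∸t (>⇒∤ (≤-<-trans (subst (_≤ t′) eq (m∸n≤m t′ t)) t′<q))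

solution-unique : ∀ {q N a t t′} → Prime q → ¬ q ∣ N → t < q → t′ < q →
                  q ∣ a + t * N → q ∣ a + t′ * N → t ≡ t′
solution-unique {t = t} {t′} pq q∤N t<q t′<q q∣a+tN q∣a+t′N with ≤-total t t′
... | inj₁ t≤t′ = solution-unique-≤ pq q∤N t≤t′ t′<q q∣a+tN q∣a+t′N
... | inj₂ t′≤t = sym (solution-unique-≤ pq q∤N t′≤t t<q q∣a+t′N q∣a+tN)

Linked-shift : ∀ {M xs} t → Linked _<_ xs → Linked _<_ (shift M t xs)
Linked-shift {M} t = Linked.map⁺ ∘′ Linked.map (+-monoˡ-< (t * M))

gaps-shift : ∀ M t xs → gaps (shift M t xs) ≡ gaps xs
gaps-shift M t [] = refl
gaps-shift M t (a ∷ []) = refl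
gaps-shift M t (a ∷ b ∷ r) = cong₂ _∷_ gap (gaps-shift M t (b ∷ r))
  where
  gap : (b + t * M) ∸ (a + t * M) ≡ b ∸ a
  gap = trans (cong₂ _∸_ (+-comm b (t * M)) (+-comm a (t * M))) ([m+n]∸[m+o]≡n∸o (t * M) b a)

head<∈tail : ∀ {x xs y} → Linked _<_ (x ∷ xs) → y ∈ xs → x < y
head<∈tail (x<y ∷ lk) = All.lookup (Linked.Linked⇒All <-trans x<y lk)

head≤∈ : ∀ {x xs y} → Linked _<_ (x ∷ xs) → y ∈ x ∷ xs → x ≤ y
head≤∈ lk (here refl) = ≤-refl
head≤∈ lk (there y∈xs) = <⇒≤ (head<∈tail lk y∈xs)

∈≤head+sum-gaps : ∀ {x xs y} → Linked _<_ (x ∷ xs) → y ∈ x ∷ xs →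
                  y ≤ x + sum (gaps (x ∷ xs))
∈≤head+sum-gaps lk (here refl) = m≤m+n _ _
∈≤head+sum-gaps {x} {b ∷ r} {y} (x<b ∷ lk) (there y∈b∷r) = begin
  y                                  ≤⟨ ∈≤head+sum-gaps lk y∈b∷r ⟩
  b + sum (gaps (b ∷ r))             ≡⟨ cong (_+ sum (gaps (b ∷ r))) (m+[n∸m]≡n (<⇒≤ x<b)) ⟨
  x + (b ∸ x) + sum (gaps (b ∷ r))   ≡⟨ +-assoc x (b ∸ x) _ ⟩
  x + ((b ∸ x) + sum (gaps (b ∷ r))) ∎
  where open ≤-Reasoning

∈-span : ∀ {xs a b} → Linked _<_ xs → a ∈ xs → b ∈ xs → b ∸ a ≤ sum (gaps xs)
∈-span {x ∷ xs} {a} {b} lk a∈ b∈ = begin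
  b ∸ a                       ≤⟨ ∸-mono (∈≤head+sum-gaps lk b∈) (head≤∈ lk a∈) ⟩
  x + sum (gaps (x ∷ xs)) ∸ x ≡⟨ m+n∸m≡n x _ ⟩
  sum (gaps (x ∷ xs))         ∎
  where open ≤-Reasoning

lookup-injective : ∀ {xs} → Linked _<_ xs → ∀ i k → lookup xs i ≡ lookup xs k → i ≡ k
lookup-injective {_ ∷ _} lk fzero fzero _ = refl
lookup-injective {_ ∷ _} lk fzero (fsuc k) eq = contradiction eq (<⇒≢ (head<∈tail lk (∈-lookup k)))
lookup-injective {_ ∷ _} lk (fsuc i) fzero eq = contradiction (sym eq) (<⇒≢ (head<∈tail lk (∈-lookup i)))
lookup-injective {_ ∷ _} lk (fsuc i) (fsuc k) eq = cong fsuc (lookup-injective (Linked.tail lk) i k eq)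

dropAt-map : ∀ (f : ℕ → ℕ) k xs → dropAt k (map f xs) ≡ map f (dropAt k xs)
dropAt-map f k [] = refl
dropAt-map f zero (x ∷ xs) = refl
dropAt-map f (suc k) (x ∷ xs) = cong (f x ∷_) (dropAt-map f k xs)

dropAt⊆ : ∀ k (xs : List ℕ) → dropAt k xs ⊆ xs
dropAt⊆ zero (x ∷ xs) y∈ = there y∈
dropAt⊆ (suc k) (x ∷ xs) (here y≡x) = here y≡x
dropAt⊆ (suc k) (x ∷ xs) (there y∈) = there (dropAt⊆ k xs y∈)

∈-dropAt⁺ : ∀ {y} xs (i : Fin (length xs)) → y ∈ xs → y ≢ lookup xs i →
            y ∈ dropAt (toℕ i) xs
∈-dropAt⁺ (x ∷ xs) fzero (here y≡x) y≢x = contradiction y≡x y≢x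
∈-dropAt⁺ (x ∷ xs) fzero (there y∈) _ = y∈
∈-dropAt⁺ (x ∷ xs) (fsuc i) (here y≡x) _ = here y≡x
∈-dropAt⁺ (x ∷ xs) (fsuc i) (there y∈) y≢ = there (∈-dropAt⁺ xs i y∈ y≢)

lookup∉dropAt : ∀ {xs} → Linked _<_ xs → ∀ i → lookup xs i ∉ dropAt (toℕ i) xs
lookup∉dropAt {_ ∷ _} lk fzero x∈ = <-irrefl refl (head<∈tail lk x∈)
lookup∉dropAt {_ ∷ _} lk (fsuc i) (here eq) = <-irrefl (sym eq) (head<∈tail lk (∈-lookup i))
lookup∉dropAt {_ ∷ _} lk (fsuc i) (there x∈) = lookup∉dropAt (Linked.tail lk) i x∈

Linked-dropAt : ∀ {xs} k → Linked _<_ xs → Linked _<_ (dropAt k xs)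
Linked-dropAt k [] = []
Linked-dropAt zero [-] = []
Linked-dropAt (suc k) [-] = [-]
Linked-dropAt zero (_ ∷ lk) = lk
Linked-dropAt (suc zero) (_ ∷ [-]) = [-]
Linked-dropAt (suc zero) (a<b ∷ b<c ∷ lk) = <-trans a<b b<c ∷ lk
Linked-dropAt (suc (suc k)) (a<b ∷ lk) = a<b ∷ Linked-dropAt (suc k) lk

∸-split : ∀ {a b c} → a ≤ b → b ≤ c → c ∸ a ≡ (b ∸ a) + (c ∸ b)
∸-split {a} {b} {c} a≤b b≤c = begin
  c ∸ a                           ≡⟨ cong (_∸ a) (m+[n∸m]≡n b≤c) ⟨
  b + (c ∸ b) ∸ a                 ≡⟨ cong (λ m → m + (c ∸ b) ∸ a) (m+[n∸m]≡n a≤b) ⟨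
  a + (b ∸ a) + (c ∸ b) ∸ a       ≡⟨ cong (_∸ a) (+-assoc a (b ∸ a) (c ∸ b)) ⟩
  a + ((b ∸ a) + (c ∸ b)) ∸ a     ≡⟨ m+n∸m≡n a _ ⟩
  (b ∸ a) + (c ∸ b)               ∎
  where open ≡-Reasoning

gaps-dropAt : ∀ {xs} k → Linked _<_ xs → suc k < length (gaps xs) →
              gaps (dropAt (suc k) xs) ≡ mergeAt k (gaps xs)
gaps-dropAt {a ∷ b ∷ c ∷ r} zero (a<b ∷ b<c ∷ _) _ =
  cong (_∷ gaps (c ∷ r)) (∸-split (<⇒≤ a<b) (<⇒≤ b<c))
gaps-dropAt {a ∷ b ∷ r} (suc k) (_ ∷ lk) (s≤s k<) = cong ((b ∸ a) ∷_) (gaps-dropAt k lk k<)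
gaps-dropAt zero (_ ∷ [-]) (s≤s ())

length-mergeAt : ∀ k (l : List ℕ) → suc k < length l → length (mergeAt k l) ≡ length l ∸ 1
length-mergeAt zero (a ∷ b ∷ r) _ = refl
length-mergeAt (suc k) (a ∷ b ∷ r) (s≤s k<) = cong suc (length-mergeAt k (b ∷ r) k<)
length-mergeAt k (a ∷ []) (s≤s ())

sum-mergeAt : ∀ k (l : List ℕ) → sum (mergeAt k l) ≡ sum l
sum-mergeAt zero [] = refl
sum-mergeAt zero (a ∷ []) = refl
sum-mergeAt zero (a ∷ b ∷ r) = +-assoc a b (sum r)
sum-mergeAt (suc k) [] = refl
sum-mergeAt (suc k) (a ∷ r) = cong (a +_) (sum-mergeAt k r)

length-gaps : ∀ x xs → length (gaps (x ∷ xs)) ≡ length xs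
length-gaps x [] = refl
length-gaps x (y ∷ xs) = cong suc (length-gaps y xs)

ConsecCoprime-shift : ∀ {M xs} t → ConsecCoprime M xs → ConsecCoprime M (shift M t xs)
ConsecCoprime-shift {M} {xs} t (lk , cop , closed) =
  Linked-shift t lk , All.map⁺ (All.map (coprime-+-* t) cop) , closed′
  where
  f : ℕ → ℕ
  f x = x + t * M
  closed′ : ∀ z → (∃ λ a → a ∈ shift M t xs × a ≤ z) →
            (∃ λ b → b ∈ shift M t xs × z ≤ b) → Coprime z M → z ∈ shift M t xs
  closed′ z (a , a∈ , a≤z) (b , b∈ , z≤b) cz with ∈-map⁻ f a∈ | ∈-map⁻ f b∈
  ... | x , x∈ , refl | x′ , x′∈ , refl =
    subst (_∈ shift M t xs) z′+tM≡z
      (∈-map⁺ f (closed z′ (x , x∈ , x≤z′) (x′ , x′∈ , z′≤x′) cz′))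
    where
    z′ = z ∸ t * M
    z′+tM≡z : z′ + t * M ≡ z
    z′+tM≡z = m∸n+n≡m (≤-trans (m≤n+m (t * M) x) a≤z)
    x≤z′ : x ≤ z′
    x≤z′ = +-cancelʳ-≤ (t * M) x z′ (subst (f x ≤_) (sym z′+tM≡z) a≤z)
    z′≤x′ : z′ ≤ x′
    z′≤x′ = +-cancelʳ-≤ (t * M) z′ x′ (subst (_≤ f x′) (sym z′+tM≡z) z≤b)
    cz′ : Coprime z′ M
    cz′ = coprime-+-*⁻ t (subst (λ w → Coprime w M) (sym z′+tM≡z) cz)

ConsecCoprime-sieve : ∀ {q M xs ys} → Prime q → ConsecCoprime M xs → Linked _<_ ys → ys ⊆ xs →
                      (∀ {x} → x ∈ xs → ¬ q ∣ x → x ∈ ys) →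
                      (∀ {y} → y ∈ ys → ¬ q ∣ y) →
                      ConsecCoprime (q * M) ys
ConsecCoprime-sieve {q} {M} {ys = ys} pq (_ , cop , closed) lk ys⊆xs keep sifted =
  lk , All.tabulate coprime-qM , closed′
  where
  coprime-qM : ∀ {y} → y ∈ ys → Coprime y (q * M)
  coprime-qM y∈ = coprime-* (prime∤⇒coprime pq (sifted y∈)) (All.lookup cop (ys⊆xs y∈))
  closed′ : ∀ z → (∃ λ a → a ∈ ys × a ≤ z) → (∃ λ b → b ∈ ys × z ≤ b) →
            Coprime z (q * M) → z ∈ ys
  closed′ z (a , a∈ , a≤z) (b , b∈ , z≤b) cz =
    keep (closed z (a , ys⊆xs a∈ , a≤z) (b , ys⊆xs b∈ , z≤b) (coprime-*⁻ {q = q} cz))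
         (λ q∣z → ∣∧∣⇒¬coprime (prime⇒1< pq) q∣z (m∣m*n M) cz)

short-run-¬two-multiples : ∀ {M q ys a b} → 2 ∣ M → ¬ 2 ∣ q → ConsecCoprime M ys →
                           sum (gaps ys) < 2 * q →
                           a ∈ ys → b ∈ ys → a < b → q ∣ a → ¬ q ∣ b
short-run-¬two-multiples {M} {q} {ys} {a} {b} 2∣M 2∤q (lk , cop , _) short a∈ b∈ a<b q∣a q∣b =
  odd b∈ (subst (2 ∣_) a+q≡b (odd+odd⇒even a q (odd a∈) 2∤q))
  where
  odd : ∀ {y} → y ∈ ys → ¬ 2 ∣ y
  odd y∈ 2∣y = ∣∧∣⇒¬coprime (s≤s (s≤s z≤n)) 2∣y 2∣M (All.lookup cop y∈)
  a+[b∸a]≡b : a + (b ∸ a) ≡ b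
  a+[b∸a]≡b = m+[n∸m]≡n (<⇒≤ a<b)
  b∸a≡q : b ∸ a ≡ q
  b∸a≡q = 0<m<2n∧n∣m⇒m≡n (m<n⇒0<n∸m a<b) (≤-<-trans (∈-span lk a∈ b∈) short)
                         (∣m+n∣m⇒∣n (subst (q ∣_) (sym a+[b∸a]≡b) q∣b) q∣a)
  a+q≡b : a + q ≡ b
  a+q≡b = trans (cong (a +_) (sym b∸a≡q)) a+[b∸a]≡b

short-run-multiple-unique : ∀ {M q ys a b} → 2 ∣ M → ¬ 2 ∣ q → ConsecCoprime M ys →
                            sum (gaps ys) < 2 * q →
                            a ∈ ys → b ∈ ys → q ∣ a → q ∣ b → a ≡ b
short-run-multiple-unique {a = a} {b} 2∣M 2∤q run short a∈ b∈ q∣a q∣b with <-cmp a b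
... | tri< a<b _ _ = contradiction q∣b (short-run-¬two-multiples 2∣M 2∤q run short a∈ b∈ a<b q∣a)
... | tri≈ _ a≡b _ = a≡b
... | tri> _ _ b<a = contradiction q∣a (short-run-¬two-multiples 2∣M 2∤q run short b∈ a∈ b<a q∣b)

module Occurrence {p q : ℕ} (3≤p : 3 ≤ p) (next : NextPrime p q)
                  {x₀ : ℕ} {rest : List ℕ} (run : ConsecCoprime (primorial p) (x₀ ∷ rest))
                  (short : sum (gaps (x₀ ∷ rest)) < 2 * q) where

  N N′ : ℕ
  N = primorial p
  N′ = primorial q

  xs : List ℕ
  xs = x₀ ∷ rest

  pq : Prime q
  pq = proj₁ next

  p<q : p < q
  p<q = proj₁ (proj₂ next)

  N′≡qN : N′ ≡ q * N
  N′≡qN = primorial-nextPrime next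

  q∤N : ¬ q ∣ N
  q∤N = prime∤primorial pq p<q

  2∣N : 2 ∣ N
  2∣N = prime∣primorial prime[2] (≤-trans (s≤s (s≤s z≤n)) 3≤p)

  2∤q : ¬ 2 ∣ q
  2∤q 2∣q with prime⇒irreducible pq 2∣q
  ... | inj₂ refl = <⇒≱ p<q (≤-trans (s≤s (s≤s z≤n)) 3≤p)

  copy : ℕ → List ℕ
  copy t = shift N t xs

  copy-run : ∀ t → ConsecCoprime N (copy t)
  copy-run t = ConsecCoprime-shift t run

  copy-entry-multiple-unique : ∀ t {x x′} → x ∈ xs → x′ ∈ xs →
                               q ∣ x + t * N → q ∣ x′ + t * N → x ≡ x′
  copy-entry-multiple-unique t {x} {x′} x∈ x′∈ q∣x+tN q∣x′+tN = +-cancelʳ-≡ (t * N) x x′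
    (short-run-multiple-unique 2∣N 2∤q (copy-run t) copy-short
      (∈-map⁺ _ x∈) (∈-map⁺ _ x′∈) q∣x+tN q∣x′+tN)
    where
    copy-short : sum (gaps (copy t)) < 2 * q
    copy-short = subst (λ g → sum g < 2 * q) (sym (gaps-shift N t xs)) short

  closing : ℕ → ℕ
  closing a = proj₁ (∃-solution pq q∤N a)

  closing<q : ∀ a → closing a < q
  closing<q a = proj₁ (proj₂ (∃-solution pq q∤N a))

  q∣closing : ∀ a → q ∣ a + closing a * N
  q∣closing a = proj₂ (proj₂ (∃-solution pq q∤N a))

  closing-unique : ∀ a t → t < q → q ∣ a + t * N → t ≡ closing a
  closing-unique a t t<q q∣a+tN = solution-unique pq q∤N t<q (closing<q a) q∣a+tN (q∣closing a)

  T : Fin (length xs) → ℕ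
  T i = closing (lookup xs i)

  T-closes : ∀ i → T i < q × q ∣ lookup xs i + T i * N
                   × (∀ t → t < q → q ∣ lookup xs i + t * N → t ≡ T i)
  T-closes i = closing<q xᵢ , q∣closing xᵢ , closing-unique xᵢ
    where xᵢ = lookup xs i

  T-injective : Injective _≡_ _≡_ T
  T-injective {i} {k} Ti≡Tk = lookup-injective (proj₁ run) i k
    (copy-entry-multiple-unique (T i) (∈-lookup i) (∈-lookup k) (q∣closing (lookup xs i))
      (subst (λ t → q ∣ lookup xs k + t * N) (sym Ti≡Tk) (q∣closing (lookup xs k))))

  generic-copy-occurs : ∀ t → t < q → (∀ i → t ≢ T i) → OccursAt N′ (gaps xs) (copy t)
  generic-copy-occurs t t<q t≢T =
    subst (λ M → ConsecCoprime M (copy t)) (sym N′≡qN)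
      (ConsecCoprime-sieve pq (copy-run t) (proj₁ (copy-run t)) (λ y∈ → y∈) (λ y∈ _ → y∈) sifted)
    , gaps-shift N t xs
    where
    sifted : ∀ {y} → y ∈ copy t → ¬ q ∣ y
    sifted y∈ q∣y with ∈-map⁻ _ y∈
    ... | x , x∈ , refl =
      t≢T (index x∈) (trans (closing-unique x t t<q q∣y) (cong closing (lookup-index x∈)))

  closing-copy-sieved : ∀ i → ConsecCoprime N′ (dropAt (toℕ i) (copy (T i)))
  closing-copy-sieved i = subst₂ ConsecCoprime (sym N′≡qN) (sym (dropAt-map f (toℕ i) xs))
    (ConsecCoprime-sieve pq (copy-run t) (Linked-shift t (Linked-dropAt (toℕ i) (proj₁ run)))
      (Subset.map⁺ f (dropAt⊆ (toℕ i) xs)) keep sifted)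
    where
    t = T i
    xᵢ = lookup xs i
    f : ℕ → ℕ
    f x = x + t * N
    keep : ∀ {y} → y ∈ copy t → ¬ q ∣ y → y ∈ shift N t (dropAt (toℕ i) xs)
    keep y∈ q∤y with ∈-map⁻ f y∈
    ... | x , x∈ , refl = ∈-map⁺ f (∈-dropAt⁺ xs i x∈ λ { refl → q∤y (q∣closing xᵢ) })
    sifted : ∀ {y} → y ∈ shift N t (dropAt (toℕ i) xs) → ¬ q ∣ y
    sifted y∈ q∣y with ∈-map⁻ f y∈
    ... | x , x∈ , refl = lookup∉dropAt (proj₁ run) i (subst (_∈ dropAt (toℕ i) xs)
      (copy-entry-multiple-unique t (dropAt⊆ (toℕ i) xs x∈) (∈-lookup i) q∣y (q∣closing xᵢ)) x∈)

  closing-copy-occurs : ∀ i → 0 < toℕ i → toℕ i < length (gaps xs) →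
    OccursAt N′ (mergeAt (toℕ i ∸ 1) (gaps xs)) (dropAt (toℕ i) (copy (T i)))
    × length (mergeAt (toℕ i ∸ 1) (gaps xs)) ≡ length (gaps xs) ∸ 1
    × sum (mergeAt (toℕ i ∸ 1) (gaps xs)) ≡ sum (gaps xs)
  closing-copy-occurs (fsuc k) _ k+1<j =
    (closing-copy-sieved (fsuc k) , gaps-closing-copy)
    , length-mergeAt (toℕ k) (gaps xs) k+1<j
    , sum-mergeAt (toℕ k) (gaps xs)
    where
    t = T (fsuc k)
    gaps-closing-copy : gaps (dropAt (suc (toℕ k)) (copy t)) ≡ mergeAt (toℕ k) (gaps xs)
    gaps-closing-copy = begin
      gaps (dropAt (suc (toℕ k)) (copy t))       ≡⟨ cong gaps (dropAt-map _ (suc (toℕ k)) xs) ⟩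
      gaps (shift N t (dropAt (suc (toℕ k)) xs)) ≡⟨ gaps-shift N t _ ⟩
      gaps (dropAt (suc (toℕ k)) xs)             ≡⟨ gaps-dropAt (toℕ k) (proj₁ run) k+1<j ⟩
      mergeAt (toℕ k) (gaps xs)                  ∎
      where open ≡-Reasoning

  endpoint-copies-distinct : 0 < length (gaps xs) → T fzero ≢ T (fromℕ (length rest))
  endpoint-copies-distinct 0<j T₀≡Tⱼ = <⇒≢ (subst (0 <_) (length-gaps x₀ rest) 0<j)
    (trans (cong toℕ (T-injective T₀≡Tⱼ)) (toℕ-fromℕ (length rest)))

  closing-entry-¬coprime : ∀ i → ¬ Coprime (lookup xs i + T i * N) N′
  closing-entry-¬coprime i =
    ∣∧∣⇒¬coprime (prime⇒1< pq) (q∣closing (lookup xs i)) (prime∣primorial pq ≤-refl)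

mainTheorem3 : (p q : ℕ) → Prime p → 3 ≤ p → NextPrime p q →
  (s : List ℕ) → All (λ a → 0 < a) s → sum s < 2 * q →
  (x₀ : ℕ) (rest : List ℕ) → OccursAt (primorial p) s (x₀ ∷ rest) →
  let N = primorial p
      N' = primorial q
      xs = x₀ ∷ rest
      j = length s
  in Σ (Fin (suc (length rest)) → ℕ) λ T →
    -- (i)
    (∀ i → T i < q × q ∣ lookup xs i + T i * N
             × (∀ t → t < q → q ∣ lookup xs i + t * N → t ≡ T i))
    × Injective _≡_ _≡_ T
    -- (ii)
    × (∀ t → t < q → (∀ i → t ≢ T i) → OccursAt N' s (shift N t xs))
    -- (iii)
    × (∀ i → 0 < toℕ i → toℕ i < j →
         OccursAt N' (mergeAt (toℕ i ∸ 1) s) (dropAt (toℕ i) (shift N (T i) xs))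
         × length (mergeAt (toℕ i ∸ 1) s) ≡ j ∸ 1
         × sum (mergeAt (toℕ i ∸ 1) s) ≡ sum s)
    -- (iv)
    × (0 < j → T fzero ≢ T (fromℕ (length rest)))
    × ¬ Coprime (x₀ + T fzero * N) N'
    × ¬ Coprime (lookup xs (fromℕ (length rest)) + T (fromℕ (length rest)) * N) N'
mainTheorem3 p q _ 3≤p next s _ short x₀ rest (run , refl) =
  T , T-closes , T-injective , generic-copy-occurs , closing-copy-occurs , endpoint-copies-distinct
  , closing-entry-¬coprime fzero , closing-entry-¬coprime (fromℕ (length rest))
  where open Occurrence 3≤p next run short
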